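{- For any integers $k\ge1$ and $N\ge1$, there exist real numbers $a,b$ such that the generalized $k$-FL sequence $\mathcal{S}=\{S_{k,n}^{(a,b)}\}_{n\ge0}$ is a sequence of integers and its Zsigmondy set satisfies $|\mathcal{Z}(\mathcal{S})|\ge N$.
   Context: For real numbers $k,a,b$, the generalized $k$-FL sequence is defined by $S_{k,0}^{(a,b)}=2b$, $S_{k,1}^{(a,b)}=bk+a$, $S_{k,n}^{(a,b)}=kS_{k,n-1}^{(a,b)}+S_{k,n-2}^{(a,b)}$ for $n\ge2$. For an integer sequence $\mathcal{A}=\{a_n\}_{n\ge0}$, a prime $p$ is a primitive prime divisor for $a_n$ if $p\mid a_n$ but $p\nmid a_m$ for all $0\le m<n$ with $a_m\neq0$; the Zsigmondy set is $\mathcal{Z}(\mathcal{A})=\{n\ge0\mid a_n \text{ has no primitive prime divisor}\}$, and $|S|$ denotes cardinality. -}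

module Defs where

open import Data.Nat using (ℕ; zero; suc; _<_)
open import Data.Nat.Primality using (Prime)
open import Data.Integer as ℤ using (ℤ; +_)
open import Data.Integer.Divisibility using (_∣_)
open import Data.Rational as ℚ using (ℚ; _/_)
open import Data.Product using (Σ; _×_)
open import Relation.Binary.PropositionalEquality using (_≡_)
open import Relation.Nullary using (¬_)

ℤ→ℚ : ℤ → ℚ
ℤ→ℚ z = z / 1

S : ℚ → ℚ → ℚ → ℕ → ℚ
S k a b zero = (ℤ→ℚ (+ 2)) ℚ.* b
S k a b (suc zero) = b ℚ.* k ℚ.+ a
S k a b (suc (suc n)) = k ℚ.* S k a b (suc n) ℚ.+ S k a b n

IntegerSequence : (ℕ → ℚ) → (ℕ → ℤ) → Set
IntegerSequence s A = ∀ n → s n ≡ ℤ→ℚ (A n)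

PrimitivePrimeDivisor : (ℕ → ℤ) → ℕ → ℕ → Set
PrimitivePrimeDivisor A n p =
  Prime p × (+ p ∣ A n) × (∀ m → m < n → ¬ (A m ≡ + 0) → ¬ (+ p ∣ A m))

InZsigmondy : (ℕ → ℤ) → ℕ → Set
InZsigmondy A n = ¬ (Σ ℕ λ p → PrimitivePrimeDivisor A n p)

module Submission where

-- Take a = 0 and b = B, where
--   B = L₁ · L₂ ⋯ L_N
-- is the product of the first N nonzero terms of the k-Lucas-type sequence
-- L = S_k^{(0,1)} (L₀ = 2, L₁ = k, L_{n+2} = k L_{n+1} + L_n).  By
-- homogeneity S_k^{(0,B)} = B · L, so for 1 ≤ n ≤ N the term B·Lₙ divides
-- B², hence each of its prime divisors already divides S₀ = 2B ≠ 0: none of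
-- the indices 1, …, N has a primitive prime divisor.

open import Defs
open import Data.Nat using (ℕ; _≥_; zero; suc; s≤s; z≤n; _<_; NonZero; >-nonZero; ≢-nonZero⁻¹)
import Data.Nat as ℕ
import Data.Nat.Properties as ℕP
open import Data.Nat.Divisibility using (_∣_; ∣-trans; ∣n⇒∣m*n; *-monoʳ-∣)
open import Data.Nat.ListAction using (product)
open import Data.Nat.ListAction.Properties using (∈⇒∣product; product≢0)
open import Data.Nat.Primality using (Prime; euclidsLemma)
import Data.Nat.Coprimality as Coprimality
open import Data.Nat.Tactic.RingSolver using (solve-∀)
open import Data.List using (applyUpTo)
open import Data.List.Membership.Propositional.Properties using (∈-applyUpTo⁺)
open import Data.List.Relation.Unary.All.Properties using (applyUpTo⁺₁)
open import Data.Fin using (Fin; toℕ)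
import Data.Fin.Properties as FinP
open import Data.Integer as ℤ using (ℤ; +_)
import Data.Integer.Properties as ℤP
open import Data.Integer.Divisibility using () renaming (_∣_ to _∣ℤ_)
open import Data.Rational as ℚ using (ℚ; mkℚ)
import Data.Rational.Properties as ℚP
open import Data.Product using (Σ; _×_; _,_)
open import Data.Sum using (inj₁; inj₂)
open import Function.Definitions using (Injective)
open import Relation.Binary.PropositionalEquality
open import Relation.Nullary using (¬_)

ℕ→ℚ-mkℚ : ∀ n → ℤ→ℚ (+ n) ≡ mkℚ (+ n) 0 (Coprimality.sym (Coprimality.1-coprimeTo n))
ℕ→ℚ-mkℚ n = ℚP.normalize-coprime _

ℕ→ℚ-+ : ∀ m n → ℤ→ℚ (+ m) ℚ.+ ℤ→ℚ (+ n) ≡ ℤ→ℚ (+ (m ℕ.+ n))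
ℕ→ℚ-+ m n rewrite ℕ→ℚ-mkℚ m | ℕ→ℚ-mkℚ n = cong (ℚ._/ 1) (begin
  + m ℤ.* + 1 ℤ.+ + n ℤ.* + 1  ≡⟨ cong₂ ℤ._+_ (ℤP.*-identityʳ (+ m)) (ℤP.*-identityʳ (+ n)) ⟩
  + m ℤ.+ + n                  ≡⟨ ℤP.pos-+ m n ⟨
  + (m ℕ.+ n)                  ∎)
  where open ≡-Reasoning

ℕ→ℚ-* : ∀ m n → ℤ→ℚ (+ m) ℚ.* ℤ→ℚ (+ n) ≡ ℤ→ℚ (+ (m ℕ.* n))
ℕ→ℚ-* m n rewrite ℕ→ℚ-mkℚ m | ℕ→ℚ-mkℚ n = cong (ℚ._/ 1) (sym (ℤP.pos-* m n))

FLℕ : ℕ → ℕ → ℕ → ℕ → ℕ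
FLℕ k a b zero = 2 ℕ.* b
FLℕ k a b (suc zero) = b ℕ.* k ℕ.+ a
FLℕ k a b (suc (suc n)) = k ℕ.* FLℕ k a b (suc n) ℕ.+ FLℕ k a b n

S-natural : ∀ k a b n →
  S (ℤ→ℚ (+ k)) (ℤ→ℚ (+ a)) (ℤ→ℚ (+ b)) n ≡ ℤ→ℚ (+ FLℕ k a b n)
S-natural k a b zero = ℕ→ℚ-* 2 b
S-natural k a b (suc zero)
  rewrite ℕ→ℚ-* b k = ℕ→ℚ-+ (b ℕ.* k) a
S-natural k a b (suc (suc n))
  rewrite S-natural k a b (suc n) | S-natural k a b n
        | ℕ→ℚ-* k (FLℕ k a b (suc n)) = ℕ→ℚ-+ (k ℕ.* FLℕ k a b (suc n)) (FLℕ k a b n)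

FLℕ-homogeneous : ∀ k c a b n → FLℕ k (c ℕ.* a) (c ℕ.* b) n ≡ c ℕ.* FLℕ k a b n
FLℕ-homogeneous k c a b zero = scale-2 c b
  where
  scale-2 : ∀ c b → 2 ℕ.* (c ℕ.* b) ≡ c ℕ.* (2 ℕ.* b)
  scale-2 = solve-∀
FLℕ-homogeneous k c a b (suc zero) = scale-initial c a b k
  where
  scale-initial : ∀ c a b k → c ℕ.* b ℕ.* k ℕ.+ c ℕ.* a ≡ c ℕ.* (b ℕ.* k ℕ.+ a)
  scale-initial = solve-∀
FLℕ-homogeneous k c a b (suc (suc n))
  rewrite FLℕ-homogeneous k c a b (suc n) | FLℕ-homogeneous k c a b n =
    scale-step c k (FLℕ k a b (suc n)) (FLℕ k a b n)
  where
  scale-step : ∀ c k x y → k ℕ.* (c ℕ.* x) ℕ.+ c ℕ.* y ≡ c ℕ.* (k ℕ.* x ℕ.+ y)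
  scale-step = solve-∀

lucas : ℕ → ℕ → ℕ
lucas k = FLℕ k 0 1

FLℕ-0b : ∀ k b n → FLℕ k 0 b n ≡ b ℕ.* lucas k n
FLℕ-0b k b n =
  subst₂ (λ a b′ → FLℕ k a b′ n ≡ b ℕ.* lucas k n)
    (ℕP.*-zeroʳ b) (ℕP.*-identityʳ b) (FLℕ-homogeneous k b 0 1 n)

lucas-positive : ∀ k → .{{NonZero k}} → ∀ n → 0 < lucas k n
lucas-positive k zero = s≤s z≤n
lucas-positive (suc k) (suc zero) = s≤s z≤n
lucas-positive k (suc (suc n)) =
  ℕP.<-≤-trans (lucas-positive k n) (ℕP.m≤n+m (lucas k n) _)

lucasProduct : ℕ → ℕ → ℕ
lucasProduct k N = product (applyUpTo (λ i → lucas k (suc i)) N)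

lucas-∣-lucasProduct : ∀ k {N i} → i < N → lucas k (suc i) ∣ lucasProduct k N
lucas-∣-lucasProduct k i<N = ∈⇒∣product (∈-applyUpTo⁺ (λ i → lucas k (suc i)) i<N)

lucasProduct-nonZero : ∀ k → .{{NonZero k}} → ∀ N → NonZero (lucasProduct k N)
lucasProduct-nonZero k N =
  product≢0 (applyUpTo⁺₁ _ N (λ {i} _ → >-nonZero (lucas-positive k (suc i))))

-- If d ∣ c then c·d ∣ c², so every prime factor of c·d is one of c.
prime-∣-product-of-divisor : ∀ {p} c {d} → Prime p → d ∣ c → p ∣ c ℕ.* d → p ∣ c
prime-∣-product-of-divisor c p-prime d∣c p∣cd
  with euclidsLemma c c p-prime (∣-trans p∣cd (*-monoʳ-∣ c d∣c))
... | inj₁ p∣c = p∣c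
... | inj₂ p∣c = p∣c

no-primitive-divisor : ∀ (A : ℕ → ℤ) {m n} → m < n → ¬ A m ≡ + 0 →
  (∀ p → Prime p → + p ∣ℤ A n → + p ∣ℤ A m) → InZsigmondy A n
no-primitive-divisor A m<n Am≢0 inherited (p , p-prime , p∣An , not-earlier) =
  not-earlier _ m<n Am≢0 (inherited p p-prime p∣An)

mainTheorem4 : (k : ℤ) → k ℤ.≥ + 1 → (N : ℕ) → N ≥ 1 →
    Σ ℚ λ a → Σ ℚ λ b → Σ (ℕ → ℤ) λ A →
    IntegerSequence (S (ℤ→ℚ k) a b) A ×
    Σ (Fin N → ℕ) λ f → Injective _≡_ _≡_ f × (∀ i → InZsigmondy A (f i))
mainTheorem4 (+ k) (ℤ.+≤+ k≥1) N _ =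
  ℤ→ℚ (+ 0) , ℤ→ℚ (+ B) , A , S-natural k 0 B , index , index-injective , zsigmondy
  where
  instance
    k≢0 : NonZero k
    k≢0 = >-nonZero k≥1
    B≢0 : NonZero (lucasProduct k N)
    B≢0 = lucasProduct-nonZero k N
  B : ℕ
  B = lucasProduct k N
  A : ℕ → ℤ
  A n = + FLℕ k 0 B n
  index : Fin N → ℕ
  index i = suc (toℕ i)
  index-injective : Injective _≡_ _≡_ index
  index-injective eq = FinP.toℕ-injective (ℕP.suc-injective eq)
  -- S₀ = 2B is nonzero and every prime dividing Sₙ = B·Lₙ (1 ≤ n ≤ N) divides it.
  A₀≢0 : ¬ A 0 ≡ + 0
  A₀≢0 eq = ≢-nonZero⁻¹ (2 ℕ.* B) {{ℕP.m*n≢0 2 B}} (ℤP.+-injective eq)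
  zsigmondy : ∀ i → InZsigmondy A (index i)
  zsigmondy i = no-primitive-divisor A (s≤s z≤n) A₀≢0 λ p p-prime p∣Aₙ →
    ∣n⇒∣m*n 2 (prime-∣-product-of-divisor B p-prime (lucas-∣-lucasProduct k (FinP.toℕ<n i))
      (subst (p ∣_) (FLℕ-0b k B (index i)) p∣Aₙ))
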